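{- Let $n,r,k\in\mathbb N$ with $r\geq 2$, $r$ dividing $n$, and $1\leq k<n/r$. Then there exists a graph $G$ on $n$ vertices whose degree sequence $d_1\leq\dots\leq d_n$ satisfies $d_i=(r-2)n/r+k-1$ for all $1\leq i\leq k$; $d_i=(r-1)n/r$ for all $k+1\leq i\leq (r-2)n/r+k$; $d_i=n-k-1$ for all $(r-2)n/r+k+1\leq i\leq n-k+1$; $d_i=n-1$ for all $n-k+2\leq i\leq n$; but such that $G$ does not contain a perfect $K_r$-packing.
   Context: A perfect $K_r$-packing in $G$ is a collection of vertex-disjoint copies of the complete graph $K_r$ in $G$ covering all vertices of $G$. The degree sequence lists vertex degrees in non-decreasing order. -}

module Defs where

open import Data.Nat using (ℕ; zero; suc; _+_; _*_; _∸_; _≤_; _<_)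
open import Data.Nat.Divisibility using (_∣_; quotient)
open import Data.Bool using (Bool; true; false)
open import Data.Fin using (Fin; toℕ)
open import Data.List using (List; length; filterᵇ; allFin)
open import Data.Product using (Σ; ∃; ∃-syntax; _×_; _,_)
open import Relation.Binary.PropositionalEquality using (_≡_; _≢_)
open import Function.Bundles using (_↔_; Inverse)
open import Function.Definitions using (Injective)

record Graph (n : ℕ) : Set where
  field
    adj   : Fin n → Fin n → Bool
    sym   : ∀ u v → adj u v ≡ adj v u
    irrefl : ∀ v → adj v v ≡ false
open Graph public

degree : ∀ {n} → Graph n → Fin n → ℕ
degree {n} G v = length (filterᵇ (adj G v) (allFin n))

record KrCopy {n : ℕ} (G : Graph n) (r : ℕ) : Set where
  field
    emb      : Fin r → Fin n
    emb-inj  : Injective _≡_ _≡_ emb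
    clique   : ∀ i j → i ≢ j → adj G (emb i) (emb j) ≡ true
open KrCopy public

record PerfectKrPacking {n : ℕ} (G : Graph n) (r : ℕ) : Set where
  field
    m        : ℕ
    copies   : Fin m → KrCopy G r
    cover    : ∀ v → ∃[ c ] ∃[ i ] emb (copies c) i ≡ v
    disjoint : ∀ c c′ i i′ → emb (copies c) i ≡ emb (copies c′) i′ → c ≡ c′

-- "G has degree sequence d" (d indexed 1..n via Fin n, i ↦ d at position
-- toℕ i + 1): some bijection σ of the vertex set lists the vertices so that
-- the i-th listed vertex has degree d i.
HasDegreeSequence : ∀ {n} → Graph n → (Fin n → ℕ) → Set
HasDegreeSequence {n} G d =
  Σ (Fin n ↔ Fin n) λ σ → ∀ i → degree G (Inverse.to σ i) ≡ d i

-- Write n = rq and lay the vertices out in consecutive blocks: an independent set A of k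
-- vertices, a complete (r − 2)-partite graph B with parts of size q, a clique C of
-- 2(q − k) + 1 vertices and a set D of k − 1 universal vertices; A is joined to B and D
-- only, and B, C, D are pairwise completely joined. A copy of K_r through a vertex of A has its other
-- r − 1 vertices in B ∪ D, and B has only r − 2 parts, so the copy meets D. In a perfect
-- packing the k pairwise non-adjacent vertices of A lie in k distinct copies, which would
-- need k distinct vertices of D, but |D| = k − 1.
module Submission where

open import Defs hiding (sym)
open import Data.Nat using (ℕ; zero; suc; _+_; _*_; _∸_; _≤_; _<_; z≤n; s≤s; z<s; s<s; s≤s⁻¹; _≡ᵇ_; NonZero)
open import Data.Nat.Divisibility using (_∣_; quotient; divides)
open import Data.Nat.DivMod using (_/_; m<n⇒m/n≡0; m/n≡1+[m∸n]/n; m<n*o⇒m/o<n)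
open import Data.Nat.Properties
open import Data.Nat.Tactic.RingSolver using (solve-∀)
open import Data.Bool using (Bool; true; false; not)
open import Data.Fin using (Fin; toℕ; fromℕ<; punchIn)
import Data.Fin as Fin
import Data.Fin.Properties as Fin
open import Data.Fin.Properties using (toℕ<n; toℕ-injective; pigeonhole; punchIn-injective; punchInᵢ≢i; any?)
open import Data.List using (length; filterᵇ; tabulate)
open import Data.Product using (Σ; ∃; _×_; _,_; proj₁; proj₂)
open import Data.Empty using (⊥; ⊥-elim)
open import Function using (_∘_; id)
open import Function.Definitions using (Injective)
open import Function.Construct.Identity using (↔-id)
open import Relation.Nullary using (¬_; yes; no; contradiction)
open import Relation.Binary.PropositionalEquality

m+n≡o⇒m≡o∸n : ∀ {m n o} → m + n ≡ o → m ≡ o ∸ n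
m+n≡o⇒m≡o∸n {m} {n} eq = trans (sym (m+n∸n≡m m n)) (cong (_∸ n) eq)

m≤n<m+o⇒n∸m<o : ∀ {m n o} → m ≤ n → n < m + o → n ∸ m < o
m≤n<m+o⇒n∸m<o {m} {n} {o} m≤n n<m+o = subst (n ∸ m <_) (m+n∸m≡n m o) (∸-monoˡ-< n<m+o m≤n)

m+1≤1+n⇒m≤n : ∀ {m n} → m + 1 ≤ suc n → m ≤ n
m+1≤1+n⇒m≤n {m} {n} m+1≤ = s≤s⁻¹ (subst (_≤ suc n) (+-comm m 1) m+1≤)

m+n∸[1+n]+1≡m : ∀ m n .{{_ : NonZero m}} → m + n ∸ suc n + 1 ≡ m
m+n∸[1+n]+1≡m (suc m) n = trans (cong (_+ 1) (m+n∸n≡m m n)) (+-comm m 1)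

≡ᵇ-refl : ∀ x → (x ≡ᵇ x) ≡ true
≡ᵇ-refl zero    = refl
≡ᵇ-refl (suc x) = ≡ᵇ-refl x

≡ᵇ-sym : ∀ x y → (x ≡ᵇ y) ≡ (y ≡ᵇ x)
≡ᵇ-sym zero    zero    = refl
≡ᵇ-sym zero    (suc y) = refl
≡ᵇ-sym (suc x) zero    = refl
≡ᵇ-sym (suc x) (suc y) = ≡ᵇ-sym x y

+-cancelˡ-≡ᵇ : ∀ b x y → (b + x ≡ᵇ b + y) ≡ (x ≡ᵇ y)
+-cancelˡ-≡ᵇ zero    x y = refl
+-cancelˡ-≡ᵇ (suc b) x y = +-cancelˡ-≡ᵇ b x y

≡ᵇ-shift : ∀ {b x} y → b ≤ x → (x ≡ᵇ b + y) ≡ (x ∸ b ≡ᵇ y)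
≡ᵇ-shift {b} {x} y b≤x = trans (cong (_≡ᵇ b + y) (sym (m+[n∸m]≡n b≤x))) (+-cancelˡ-≡ᵇ b (x ∸ b) y)

bit : Bool → ℕ
bit true  = 1
bit false = 0

count : (ℕ → Bool) → ℕ → ℕ
count g zero    = 0
count g (suc l) = bit (g 0) + count (g ∘ suc) l

length-filterᵇ-tabulate : ∀ {A : Set} n (f : Fin n → A) (p : A → Bool) (g : ℕ → Bool) →
  (∀ i → p (f i) ≡ g (toℕ i)) → length (filterᵇ p (tabulate f)) ≡ count g n
length-filterᵇ-tabulate zero    f p g eq = refl
length-filterᵇ-tabulate (suc n) f p g eq with p (f Fin.zero) | g 0 | eq Fin.zero
... | true  | true  | _ = cong suc (length-filterᵇ-tabulate n (f ∘ Fin.suc) p (g ∘ suc) (eq ∘ Fin.suc))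
... | false | false | _ = length-filterᵇ-tabulate n (f ∘ Fin.suc) p (g ∘ suc) (eq ∘ Fin.suc)

count-+ : ∀ g l₁ l₂ → count g (l₁ + l₂) ≡ count g l₁ + count (λ y → g (l₁ + y)) l₂
count-+ g zero     l₂ = refl
count-+ g (suc l₁) l₂ = trans (cong (bit (g 0) +_) (count-+ (g ∘ suc) l₁ l₂)) (sym (+-assoc (bit (g 0)) _ _))

count-ext : ∀ {g h} l → (∀ y → y < l → g y ≡ h y) → count g l ≡ count h l
count-ext zero    eq = refl
count-ext (suc l) eq = cong₂ _+_ (cong bit (eq 0 z<s)) (count-ext l (λ y y<l → eq (suc y) (s<s y<l)))

count-true : ∀ {g} l → (∀ y → y < l → g y ≡ true) → count g l ≡ l
count-true zero    eq = refl
count-true (suc l) eq rewrite eq 0 z<s = cong suc (count-true l (λ y y<l → eq (suc y) (s<s y<l)))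

count-false : ∀ {g} l → (∀ y → y < l → g y ≡ false) → count g l ≡ 0
count-false zero    eq = refl
count-false (suc l) eq rewrite eq 0 z<s = count-false l (λ y y<l → eq (suc y) (s<s y<l))

count-not : ∀ g l → count (not ∘ g) l + count g l ≡ l
count-not g zero = refl
count-not g (suc l) with g 0
... | true  = trans (+-suc _ _) (cong suc (count-not (g ∘ suc) l))
... | false = cong suc (count-not (g ∘ suc) l)

count-≡ᵇ : ∀ {v} l → v < l → count (v ≡ᵇ_) l ≡ 1
count-≡ᵇ {zero}  (suc l) _         = cong suc (count-false l (λ _ _ → refl))
count-≡ᵇ {suc v} (suc l) (s<s v<l) = count-≡ᵇ l v<l

count-≢ : ∀ {v} l → v < l → count (λ y → not (v ≡ᵇ y)) l + 1 ≡ l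
count-≢ l v<l = trans (cong (count _ l +_) (sym (count-≡ᵇ l v<l))) (count-not _ l)

module _ (q : ℕ) .{{_ : NonZero q}} where

  [q+y]/q≡1+y/q : ∀ y → (q + y) / q ≡ suc (y / q)
  [q+y]/q≡1+y/q y = trans (m/n≡1+[m∸n]/n (m≤m+n q y)) (cong (λ z → suc (z / q)) (m+n∸m≡n q y))

  count-/ : ∀ M {p} → p < M → count (λ y → p ≡ᵇ y / q) (M * q) ≡ q
  count-/ (suc M) {p} p<M = begin
    count (λ y → p ≡ᵇ y / q) (q + M * q)
      ≡⟨ count-+ _ q (M * q) ⟩
    count (λ y → p ≡ᵇ y / q) q + count (λ y → p ≡ᵇ (q + y) / q) (M * q)
      ≡⟨ cong₂ _+_ (count-ext q (λ y y<q → cong (p ≡ᵇ_) (m<n⇒m/n≡0 y<q)))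
                   (count-ext (M * q) (λ y _ → cong (p ≡ᵇ_) ([q+y]/q≡1+y/q y))) ⟩
    count (λ _ → p ≡ᵇ 0) q + count (λ y → p ≡ᵇ suc (y / q)) (M * q)
      ≡⟨ first-or-later-part p<M ⟩
    q ∎
    where
    open ≡-Reasoning
    first-or-later-part : ∀ {p} → p < suc M →
      count (λ _ → p ≡ᵇ 0) q + count (λ y → p ≡ᵇ suc (y / q)) (M * q) ≡ q
    first-or-later-part {zero}  _         =
      trans (cong₂ _+_ (count-true q (λ _ _ → refl)) (count-false (M * q) (λ _ _ → refl))) (+-identityʳ q)
    first-or-later-part {suc p} (s<s p<M) =
      cong₂ _+_ (count-false q (λ _ _ → refl)) (count-/ M p<M)

  count-/≢ : ∀ M {p} → p < M → count (λ y → not (p ≡ᵇ y / q)) (M * q) + q ≡ M * q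
  count-/≢ M p<M = trans (cong (count _ (M * q) +_) (sym (count-/ M p<M))) (count-not _ (M * q))

-- Packings

nonadjacent-in-copy⇒≡ : ∀ {n r} {G : Graph n} (K : KrCopy G r) i j →
  adj G (emb K i) (emb K j) ≡ false → emb K i ≡ emb K j
nonadjacent-in-copy⇒≡ K i j nonadjacent with i Fin.≟ j
... | yes refl = refl
... | no  i≢j  = contradiction (trans (sym (clique K i j i≢j)) nonadjacent) λ ()

independent-set↪transversal : ∀ {n r a} {G : Graph n} → PerfectKrPacking G r →
  (A D : Fin n → Set) → (∀ u v → A u → A v → adj G u v ≡ false) →
  (∀ (K : KrCopy G r) i → A (emb K i) → ∃ λ j → D (emb K j)) →
  (α : Fin a → Fin n) → Injective _≡_ _≡_ α → (∀ x → A (α x)) →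
  Σ (Fin a → Fin n) λ δ → Injective _≡_ _≡_ δ × (∀ x → D (δ x))
independent-set↪transversal {G = G} P A D independent hits α α-injective α∈A =
  δ , δ-injective , λ x → proj₂ (hit x)
  where
  open PerfectKrPacking P
  copy : Fin _ → Fin m
  copy x = proj₁ (cover (α x))
  place : Fin _ → Fin _
  place x = proj₁ (proj₂ (cover (α x)))
  at-place : ∀ x → emb (copies (copy x)) (place x) ≡ α x
  at-place x = proj₂ (proj₂ (cover (α x)))
  at-place∈A : ∀ x → A (emb (copies (copy x)) (place x))
  at-place∈A x = subst A (sym (at-place x)) (α∈A x)
  hit : ∀ x → ∃ λ j → D (emb (copies (copy x)) j)
  hit x = hits (copies (copy x)) (place x) (at-place∈A x)
  δ : Fin _ → Fin _
  δ x = emb (copies (copy x)) (proj₁ (hit x))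
  δ-injective : Injective _≡_ _≡_ δ
  δ-injective {x} {y} δx≡δy = α-injective (begin
    α x                                ≡⟨ at-place x ⟨
    emb (copies (copy x)) (place x)    ≡⟨ nonadjacent-in-copy⇒≡ (copies (copy x)) _ _ nonadjacent ⟩
    emb (copies (copy x)) (place y)    ≡⟨ in-same-copy ⟩
    emb (copies (copy y)) (place y)    ≡⟨ at-place y ⟩
    α y                                ∎)
    where
    open ≡-Reasoning
    in-same-copy : emb (copies (copy x)) (place y) ≡ emb (copies (copy y)) (place y)
    in-same-copy = cong (λ c → emb (copies c) (place y)) (disjoint (copy x) (copy y) _ _ δx≡δy)
    nonadjacent : adj G (emb (copies (copy x)) (place x)) (emb (copies (copy x)) (place y)) ≡ false
    nonadjacent = independent _ _ (at-place∈A x) (subst A (sym in-same-copy) (at-place∈A y))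

injection-into-tail⇒≤ : ∀ {a n} b (δ : Fin a → Fin n) → Injective _≡_ _≡_ δ →
  (∀ x → b ≤ toℕ (δ x)) → a ≤ n ∸ b
injection-into-tail⇒≤ {a} {n} b δ δ-injective b≤δ = ≮⇒≥ no-collision
  where
  shifted : Fin a → Fin (n ∸ b)
  shifted x = fromℕ< (∸-monoˡ-< (toℕ<n (δ x)) (b≤δ x))
  shifted-injective : ∀ {x y} → shifted x ≡ shifted y → x ≡ y
  shifted-injective {x} {y} eq =
    δ-injective (toℕ-injective (∸-cancelʳ-≡ (b≤δ x) (b≤δ y) (Fin.fromℕ<-injective _ _ _ _ eq)))
  no-collision : ¬ (n ∸ b < a)
  no-collision n∸b<a with pigeonhole n∸b<a shifted
  ... | x , y , x<y , eq = Fin.<⇒≢ x<y (shifted-injective eq)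

-- The extremal graph

-- Vertices 0, …, n − 1 form consecutive blocks: a independent vertices, m parts of q vertices
-- spanning a complete multipartite graph, a clique of c vertices and u universal vertices.
module Construction (a m q c u : ℕ) .{{_ : NonZero q}} {n : ℕ} (size : n ≡ a + m * q + c + u) where

  b₂ b₃ : ℕ
  b₂ = a + m * q
  b₃ = b₂ + c

  a≤b₂ : a ≤ b₂
  a≤b₂ = m≤m+n a (m * q)

  b₂≤b₃ : b₂ ≤ b₃
  b₂≤b₃ = m≤m+n b₂ c

  a≤b₃ : a ≤ b₃
  a≤b₃ = ≤-trans a≤b₂ b₂≤b₃

  data Block : Set where
    independent multipartite complete universal : Block

  data Position (x : ℕ) : Set where
    in-independent  : x < a → Position x
    in-multipartite : a ≤ x → x < b₂ → Position x
    in-complete     : b₂ ≤ x → x < b₃ → Position x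
    in-universal    : b₃ ≤ x → Position x

  position : ∀ x → Position x
  position x with x <? a | x <? b₂ | x <? b₃
  ... | yes x<a | _        | _        = in-independent x<a
  ... | no  x≮a | yes x<b₂ | _        = in-multipartite (≮⇒≥ x≮a) x<b₂
  ... | no  _   | no  x≮b₂ | yes x<b₃ = in-complete (≮⇒≥ x≮b₂) x<b₃
  ... | no  _   | no  _    | no  x≮b₃ = in-universal (≮⇒≥ x≮b₃)

  block-of : ∀ {x} → Position x → Block
  block-of (in-independent _)    = independent
  block-of (in-multipartite _ _) = multipartite
  block-of (in-complete _ _)     = complete
  block-of (in-universal _)      = universal

  block : ℕ → Block
  block x = block-of (position x)

  block-independent : ∀ {x} → x < a → block x ≡ independent
  block-independent {x} x<a with position x
  ... | in-independent _      = refl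
  ... | in-multipartite a≤x _ = contradiction x<a (≤⇒≯ a≤x)
  ... | in-complete b₂≤x _    = contradiction x<a (≤⇒≯ (≤-trans a≤b₂ b₂≤x))
  ... | in-universal b₃≤x     = contradiction x<a (≤⇒≯ (≤-trans a≤b₃ b₃≤x))

  block-multipartite : ∀ {x} → a ≤ x → x < b₂ → block x ≡ multipartite
  block-multipartite {x} a≤x x<b₂ with position x
  ... | in-independent x<a  = contradiction x<a (≤⇒≯ a≤x)
  ... | in-multipartite _ _ = refl
  ... | in-complete b₂≤x _  = contradiction x<b₂ (≤⇒≯ b₂≤x)
  ... | in-universal b₃≤x   = contradiction x<b₂ (≤⇒≯ (≤-trans b₂≤b₃ b₃≤x))

  block-complete : ∀ {x} → b₂ ≤ x → x < b₃ → block x ≡ complete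
  block-complete {x} b₂≤x x<b₃ with position x
  ... | in-independent x<a     = contradiction (≤-trans a≤b₂ b₂≤x) (<⇒≱ x<a)
  ... | in-multipartite _ x<b₂ = contradiction b₂≤x (<⇒≱ x<b₂)
  ... | in-complete _ _        = refl
  ... | in-universal b₃≤x      = contradiction x<b₃ (≤⇒≯ b₃≤x)

  block-universal : ∀ {x} → b₃ ≤ x → block x ≡ universal
  block-universal {x} b₃≤x with position x
  ... | in-independent x<a     = contradiction (≤-trans a≤b₃ b₃≤x) (<⇒≱ x<a)
  ... | in-multipartite _ x<b₂ = contradiction (≤-trans b₂≤b₃ b₃≤x) (<⇒≱ x<b₂)
  ... | in-complete _ x<b₃     = contradiction b₃≤x (<⇒≱ x<b₃)
  ... | in-universal _         = refl

  block-a+ : ∀ {y} → y < m * q → block (a + y) ≡ multipartite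
  block-a+ {y} y<mq = block-multipartite (m≤m+n a y) (+-monoʳ-< a y<mq)

  block-b₂+ : ∀ {y} → y < c → block (b₂ + y) ≡ complete
  block-b₂+ {y} y<c = block-complete (m≤m+n b₂ y) (+-monoʳ-< b₂ y<c)

  block-b₃+ : ∀ y → block (b₃ + y) ≡ universal
  block-b₃+ y = block-universal (m≤m+n b₃ y)

  InMultipartite : ℕ → Set
  InMultipartite x = a ≤ x × x < b₂

  part : ℕ → ℕ
  part x = (x ∸ a) / q

  part<m : ∀ {x} → InMultipartite x → part x < m
  part<m (a≤x , x<b₂) = m<n*o⇒m/o<n (m≤n<m+o⇒n∸m<o a≤x x<b₂)

  edge : Block → Block → ℕ → ℕ → Bool
  edge independent  independent  _ _ = false
  edge independent  complete     _ _ = false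
  edge complete     independent  _ _ = false
  edge multipartite multipartite x y = not (part x ≡ᵇ part y)
  edge complete     complete     x y = not (x ≡ᵇ y)
  edge universal    universal    x y = not (x ≡ᵇ y)
  edge _            _            _ _ = true

  edge-sym : ∀ s t x y → edge s t x y ≡ edge t s y x
  edge-sym independent  independent  x y = refl
  edge-sym independent  multipartite x y = refl
  edge-sym independent  complete     x y = refl
  edge-sym independent  universal    x y = refl
  edge-sym multipartite independent  x y = refl
  edge-sym multipartite multipartite x y = cong not (≡ᵇ-sym (part x) (part y))
  edge-sym multipartite complete     x y = refl
  edge-sym multipartite universal    x y = refl
  edge-sym complete     independent  x y = refl
  edge-sym complete     multipartite x y = refl
  edge-sym complete     complete     x y = cong not (≡ᵇ-sym x y)
  edge-sym complete     universal    x y = refl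
  edge-sym universal    independent  x y = refl
  edge-sym universal    multipartite x y = refl
  edge-sym universal    complete     x y = refl
  edge-sym universal    universal    x y = cong not (≡ᵇ-sym x y)

  edge-irrefl : ∀ s x → edge s s x x ≡ false
  edge-irrefl independent  x = refl
  edge-irrefl multipartite x = cong not (≡ᵇ-refl (part x))
  edge-irrefl complete     x = cong not (≡ᵇ-refl x)
  edge-irrefl universal    x = cong not (≡ᵇ-refl x)

  adjacent : ℕ → ℕ → Bool
  adjacent x y = edge (block x) (block y) x y

  adjacent-blocks : ∀ {x y s t} → block x ≡ s → block y ≡ t → adjacent x y ≡ edge s t x y
  adjacent-blocks refl refl = refl

  G : Graph n
  G = record
    { adj    = λ u v → adjacent (toℕ u) (toℕ v)
    ; sym    = λ u v → edge-sym (block (toℕ u)) (block (toℕ v)) (toℕ u) (toℕ v)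
    ; irrefl = λ v → edge-irrefl (block (toℕ v)) (toℕ v)
    }

  deg : ℕ → ℕ
  deg x = count (adjacent x) n

  degree≡deg : ∀ v → degree G v ≡ deg (toℕ v)
  degree≡deg v = length-filterᵇ-tabulate n id (adj G v) (adjacent (toℕ v)) (λ _ → refl)

  count-by-blocks : ∀ {g w₁ w₂ w₃ w₄} →
    count g a ≡ w₁ → count (λ y → g (a + y)) (m * q) ≡ w₂ →
    count (λ y → g (b₂ + y)) c ≡ w₃ → count (λ y → g (b₃ + y)) u ≡ w₄ →
    count g n ≡ w₁ + w₂ + w₃ + w₄
  count-by-blocks {g} {w₁} {w₂} {w₃} {w₄} e₁ e₂ e₃ e₄ = begin
    count g n                      ≡⟨ cong (count g) size ⟩
    count g (b₃ + u)               ≡⟨ count-+ g b₃ u ⟩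
    count g b₃ + in-D              ≡⟨ cong (_+ in-D) (count-+ g b₂ c) ⟩
    count g b₂ + in-C + in-D       ≡⟨ cong (λ z → z + in-C + in-D) (count-+ g a (m * q)) ⟩
    count g a + in-B + in-C + in-D ≡⟨ cong₂ _+_ (cong₂ _+_ (cong₂ _+_ e₁ e₂) e₃) e₄ ⟩
    w₁ + w₂ + w₃ + w₄              ∎
    where
    open ≡-Reasoning
    in-B = count (λ y → g (a + y)) (m * q)
    in-C = count (λ y → g (b₂ + y)) c
    in-D = count (λ y → g (b₃ + y)) u

  value : Block → ℕ
  value independent  = m * q + u
  value multipartite = n ∸ q
  value complete     = n ∸ a ∸ 1
  value universal    = n ∸ 1

  deg-independent : ∀ {x} → x < a → deg x ≡ value independent
  deg-independent {x} x<a = trans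
    (count-by-blocks
      (count-false a λ _ y<a → adjacent-blocks x∈ (block-independent y<a))
      (count-true (m * q) λ _ y<mq → adjacent-blocks x∈ (block-a+ y<mq))
      (count-false c λ _ y<c → adjacent-blocks x∈ (block-b₂+ y<c))
      (count-true u λ y _ → adjacent-blocks x∈ (block-b₃+ y)))
    (cong (_+ u) (+-identityʳ (m * q)))
    where x∈ = block-independent x<a

  deg-multipartite : ∀ {x} → a ≤ x → x < b₂ → deg x ≡ value multipartite
  deg-multipartite {x} a≤x x<b₂ = m+n≡o⇒m≡o∸n (begin
    deg x + q
      ≡⟨ cong (_+ q) (count-by-blocks
           (count-true a λ _ y<a → adjacent-blocks x∈ (block-independent y<a))
           (count-ext (m * q) same-block)
           (count-true c λ _ y<c → adjacent-blocks x∈ (block-b₂+ y<c))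
           (count-true u λ y _ → adjacent-blocks x∈ (block-b₃+ y))) ⟩
    a + X + c + u + q
      ≡⟨ reassociate a X c u q ⟩
    a + (X + q) + c + u
      ≡⟨ cong (λ z → a + z + c + u) (count-/≢ q m (part<m (a≤x , x<b₂))) ⟩
    a + m * q + c + u
      ≡⟨ size ⟨
    n ∎)
    where
    open ≡-Reasoning
    x∈ = block-multipartite a≤x x<b₂
    X = count (λ y → not (part x ≡ᵇ y / q)) (m * q)
    same-block : ∀ y → y < m * q → adjacent x (a + y) ≡ not (part x ≡ᵇ y / q)
    same-block y y<mq = trans (adjacent-blocks x∈ (block-a+ y<mq))
      (cong (λ z → not (part x ≡ᵇ z / q)) (m+n∸m≡n a y))
    reassociate : ∀ a X c u q → a + X + c + u + q ≡ a + (X + q) + c + u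
    reassociate = solve-∀

  deg-complete : ∀ {x} → b₂ ≤ x → x < b₃ → deg x ≡ value complete
  deg-complete {x} b₂≤x x<b₃ = trans (m+n≡o⇒m≡o∸n (begin
    deg x + (a + 1)
      ≡⟨ cong (_+ (a + 1)) (count-by-blocks
           (count-false a λ _ y<a → adjacent-blocks x∈ (block-independent y<a))
           (count-true (m * q) λ _ y<mq → adjacent-blocks x∈ (block-a+ y<mq))
           (count-ext c same-block)
           (count-true u λ y _ → adjacent-blocks x∈ (block-b₃+ y))) ⟩
    m * q + Y + u + (a + 1)
      ≡⟨ reassociate a (m * q) Y u ⟩
    a + m * q + (Y + 1) + u
      ≡⟨ cong (λ z → a + m * q + z + u) (count-≢ c (m≤n<m+o⇒n∸m<o b₂≤x x<b₃)) ⟩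
    a + m * q + c + u
      ≡⟨ size ⟨
    n ∎)) (sym (∸-+-assoc n a 1))
    where
    open ≡-Reasoning
    x∈ = block-complete b₂≤x x<b₃
    Y = count (λ y → not (x ∸ b₂ ≡ᵇ y)) c
    same-block : ∀ y → y < c → adjacent x (b₂ + y) ≡ not (x ∸ b₂ ≡ᵇ y)
    same-block y y<c = trans (adjacent-blocks x∈ (block-b₂+ y<c)) (cong not (≡ᵇ-shift y b₂≤x))
    reassociate : ∀ a B Y u → B + Y + u + (a + 1) ≡ a + B + (Y + 1) + u
    reassociate = solve-∀

  deg-universal : ∀ {x} → b₃ ≤ x → x < n → deg x ≡ value universal
  deg-universal {x} b₃≤x x<n = m+n≡o⇒m≡o∸n (begin
    deg x + 1
      ≡⟨ cong (_+ 1) (count-by-blocks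
           (count-true a λ _ y<a → adjacent-blocks x∈ (block-independent y<a))
           (count-true (m * q) λ _ y<mq → adjacent-blocks x∈ (block-a+ y<mq))
           (count-true c λ _ y<c → adjacent-blocks x∈ (block-b₂+ y<c))
           (count-ext u same-block)) ⟩
    b₃ + Z + 1
      ≡⟨ +-assoc b₃ Z 1 ⟩
    b₃ + (Z + 1)
      ≡⟨ cong (b₃ +_) (count-≢ u (m≤n<m+o⇒n∸m<o b₃≤x (subst (x <_) size x<n))) ⟩
    b₃ + u
      ≡⟨ size ⟨
    n ∎)
    where
    open ≡-Reasoning
    x∈ = block-universal b₃≤x
    Z = count (λ y → not (x ∸ b₃ ≡ᵇ y)) u
    same-block : ∀ y → y < u → adjacent x (b₃ + y) ≡ not (x ∸ b₃ ≡ᵇ y)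
    same-block y _ = trans (adjacent-blocks x∈ (block-b₃+ y)) (cong not (≡ᵇ-shift y b₃≤x))

  deg≡value : ∀ {x} → x < n → deg x ≡ value (block x)
  deg≡value {x} x<n = at (position x)
    where
    at : (p : Position x) → deg x ≡ value (block-of p)
    at (in-independent x<a)       = deg-independent x<a
    at (in-multipartite a≤x x<b₂) = deg-multipartite a≤x x<b₂
    at (in-complete b₂≤x x<b₃)    = deg-complete b₂≤x x<b₃
    at (in-universal b₃≤x)        = deg-universal b₃≤x x<n

  value-mono : q ≤ a + c → a < q → ∀ {x y} → x ≤ y → value (block x) ≤ value (block y)
  value-mono q≤a+c a<q {x} {y} = at (position x) (position y)
    where
    open ≤-Reasoning
    i≤m : value independent ≤ value multipartite
    i≤m = m+n≤o⇒m≤o∸n (m * q + u) (begin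
      m * q + u + q       ≤⟨ +-monoʳ-≤ (m * q + u) q≤a+c ⟩
      m * q + u + (a + c) ≡⟨ reassociate a (m * q) c u ⟩
      a + m * q + c + u   ≡⟨ size ⟨
      n                   ∎)
      where
      reassociate : ∀ a B c u → B + u + (a + c) ≡ a + B + c + u
      reassociate = solve-∀
    m≤c : value multipartite ≤ value complete
    m≤c = subst (n ∸ q ≤_) (sym (∸-+-assoc n a 1)) (∸-monoʳ-≤ n (subst (_≤ q) (+-comm 1 a) a<q))
    c≤u : value complete ≤ value universal
    c≤u = ∸-monoˡ-≤ 1 (m∸n≤m n a)
    at : (p : Position x) (p′ : Position y) → x ≤ y → value (block-of p) ≤ value (block-of p′)
    at (in-independent _)      (in-independent _)       _   = ≤-refl
    at (in-independent _)      (in-multipartite _ _)    _   = i≤m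
    at (in-independent _)      (in-complete _ _)        _   = ≤-trans i≤m m≤c
    at (in-independent _)      (in-universal _)         _   = ≤-trans i≤m (≤-trans m≤c c≤u)
    at (in-multipartite a≤x _) (in-independent y<a)     x≤y = contradiction (≤-trans a≤x x≤y) (<⇒≱ y<a)
    at (in-multipartite _ _)   (in-multipartite _ _)    _   = ≤-refl
    at (in-multipartite _ _)   (in-complete _ _)        _   = m≤c
    at (in-multipartite _ _)   (in-universal _)         _   = ≤-trans m≤c c≤u
    at (in-complete b₂≤x _)    (in-independent y<a)     x≤y =
      contradiction (≤-trans (≤-trans a≤b₂ b₂≤x) x≤y) (<⇒≱ y<a)
    at (in-complete b₂≤x _)    (in-multipartite _ y<b₂) x≤y = contradiction (≤-trans b₂≤x x≤y) (<⇒≱ y<b₂)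
    at (in-complete _ _)       (in-complete _ _)        _   = ≤-refl
    at (in-complete _ _)       (in-universal _)         _   = c≤u
    at (in-universal b₃≤x)     (in-independent y<a)     x≤y =
      contradiction (≤-trans (≤-trans a≤b₃ b₃≤x) x≤y) (<⇒≱ y<a)
    at (in-universal b₃≤x)     (in-multipartite _ y<b₂) x≤y =
      contradiction (≤-trans (≤-trans b₂≤b₃ b₃≤x) x≤y) (<⇒≱ y<b₂)
    at (in-universal b₃≤x)     (in-complete _ y<b₃)     x≤y = contradiction (≤-trans b₃≤x x≤y) (<⇒≱ y<b₃)
    at (in-universal _)        (in-universal _)         _   = ≤-refl

  neighbour-of-independent : ∀ {x y} → x < a → adjacent x y ≡ true → y < b₃ → InMultipartite y
  neighbour-of-independent {x} {y} x<a x~y y<b₃ = at (position y)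
    where
    x∈ = block-independent x<a
    at : Position y → InMultipartite y
    at (in-independent y<a)       =
      contradiction (trans (sym x~y) (adjacent-blocks x∈ (block-independent y<a))) λ ()
    at (in-multipartite a≤y y<b₂) = a≤y , y<b₂
    at (in-complete b₂≤y y<b₃)    =
      contradiction (trans (sym x~y) (adjacent-blocks x∈ (block-complete b₂≤y y<b₃))) λ ()
    at (in-universal b₃≤y)        = contradiction y<b₃ (≤⇒≯ b₃≤y)

  same-part⇒nonadjacent : ∀ {y z} → InMultipartite y → InMultipartite z → part y ≡ part z →
    adjacent y z ≡ false
  same-part⇒nonadjacent {y} {z} (a≤y , y<b₂) (a≤z , z<b₂) same = begin
    adjacent y z           ≡⟨ adjacent-blocks (block-multipartite a≤y y<b₂) (block-multipartite a≤z z<b₂) ⟩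
    not (part y ≡ᵇ part z) ≡⟨ cong (λ p → not (p ≡ᵇ part z)) same ⟩
    not (part z ≡ᵇ part z) ≡⟨ cong not (≡ᵇ-refl (part z)) ⟩
    false                  ∎
    where open ≡-Reasoning

  copy-through-independent-meets-universal : (K : KrCopy G (2 + m)) (i : Fin (2 + m)) →
    toℕ (emb K i) < a → ∃ λ j → b₃ ≤ toℕ (emb K j)
  copy-through-independent-meets-universal K i i<a with any? (λ j → b₃ ≤? toℕ (emb K j))
  ... | yes meets  = meets
  ... | no  misses = ⊥-elim clash
    where
    other : Fin (suc m) → ℕ
    other t = toℕ (emb K (punchIn i t))
    other-multipartite : ∀ t → InMultipartite (other t)
    other-multipartite t = neighbour-of-independent i<a
      (clique K i (punchIn i t) (punchInᵢ≢i i t ∘ sym))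
      (≰⇒> λ b₃≤ → misses (punchIn i t , b₃≤))
    colour : Fin (suc m) → Fin m
    colour t = fromℕ< (part<m (other-multipartite t))
    clash : ⊥
    clash with pigeonhole (n<1+n m) colour
    ... | t₁ , t₂ , t₁<t₂ , same-colour = contradiction
      (trans (sym (clique K (punchIn i t₁) (punchIn i t₂) (Fin.<⇒≢ t₁<t₂ ∘ punchIn-injective i t₁ t₂)))
             (same-part⇒nonadjacent (other-multipartite t₁) (other-multipartite t₂)
                                    (Fin.fromℕ<-injective _ _ _ _ same-colour)))
      λ ()

  no-perfect-packing : u < a → ¬ PerfectKrPacking G (2 + m)
  no-perfect-packing u<a P = <⇒≱ u<a (subst (a ≤_) n∸b₃≡u
    (injection-into-tail⇒≤ b₃ (proj₁ transversal) (proj₁ (proj₂ transversal)) (proj₂ (proj₂ transversal))))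
    where
    a≤n : a ≤ n
    a≤n = subst (a ≤_) (sym size) (≤-trans a≤b₃ (m≤m+n b₃ u))
    n∸b₃≡u : n ∸ b₃ ≡ u
    n∸b₃≡u = trans (cong (_∸ b₃) size) (m+n∸m≡n b₃ u)
    transversal = independent-set↪transversal P (λ v → toℕ v < a) (λ v → b₃ ≤ toℕ v)
      (λ u v u<a v<a → adjacent-blocks (block-independent u<a) (block-independent v<a))
      copy-through-independent-meets-universal
      (λ x → Fin.inject≤ x a≤n) (λ {x} {y} → Fin.inject≤-injective a≤n a≤n x y)
      (λ x → subst (_< a) (sym (Fin.toℕ-inject≤ x a≤n)) (toℕ<n x))

-- With k = 1 + u and q = k + 1 + e, the clique has 2(q − k) + 1 = 3 + 2e vertices.

block-sizes : ∀ m u e → (2 + u + e) * (2 + m) ≡ suc u + m * (2 + u + e) + (3 + 2 * e) + u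
block-sizes = solve-∀

block-slack : ∀ u e → 2 + u + e + (2 + e) ≡ suc u + (3 + 2 * e)
block-slack = solve-∀

proposition4p1 : (n r k : ℕ) → 2 ≤ r → (r∣n : r ∣ n) →
    1 ≤ k → k < quotient r∣n →
    Σ (Graph n) λ G → Σ (Fin n → ℕ) λ d →
      HasDegreeSequence G d
      × (∀ (i j : Fin n) → toℕ i ≤ toℕ j → d i ≤ d j)
      × (∀ (i : Fin n) → suc (toℕ i) ≤ k →
           d i ≡ (r ∸ 2) * quotient r∣n + k ∸ 1)
      × (∀ (i : Fin n) → k + 1 ≤ suc (toℕ i) →
           suc (toℕ i) ≤ (r ∸ 2) * quotient r∣n + k →
           d i ≡ (r ∸ 1) * quotient r∣n)
      × (∀ (i : Fin n) → (r ∸ 2) * quotient r∣n + k + 1 ≤ suc (toℕ i) →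
           suc (toℕ i) ≤ n ∸ k + 1 →
           d i ≡ n ∸ k ∸ 1)
      × (∀ (i : Fin n) → n ∸ k + 2 ≤ suc (toℕ i) →
           d i ≡ n ∸ 1)
      × ¬ PerfectKrPacking G r
proposition4p1 _ (suc (suc m)) (suc u) (s≤s (s≤s z≤n)) (divides q refl) (s≤s z≤n) k<q
  with m≤n⇒∃[o]m+o≡n k<q
... | e , refl =
  G , value ∘ block ∘ toℕ , (↔-id _ , λ v → trans (degree≡deg v) (deg≡value (toℕ<n v)))
  , (λ _ _ → value-mono q≤a+c k<q)
  , (λ i i<k → trans (cong value (block-independent {toℕ i} i<k)) independent-value)
  , (λ i k<i i<b₂ → trans
       (cong value (block-multipartite {toℕ i} (m+1≤1+n⇒m≤n k<i) (subst (suc (toℕ i) ≤_) b₂≡ i<b₂)))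
       multipartite-value)
  , (λ i b₂<i i<b₃ → cong value (block-complete {toℕ i}
       (subst (_≤ toℕ i) b₂≡ (m+1≤1+n⇒m≤n b₂<i)) (subst (suc (toℕ i) ≤_) b₃≡ i<b₃)))
  , (λ i b₃<i → cong value (block-universal {toℕ i} (m+1≤1+n⇒m≤n (subst (_≤ suc (toℕ i)) b₃+1≡ b₃<i))))
  , no-perfect-packing (n<1+n u)
  where
  open Construction (suc u) m q (3 + 2 * e) u (block-sizes m u e)
  q≤a+c : q ≤ suc u + (3 + 2 * e)
  q≤a+c = subst (q ≤_) (block-slack u e) (m≤m+n q (2 + e))
  independent-value : m * q + u ≡ m * q + suc u ∸ 1
  independent-value = cong (_∸ 1) (sym (+-suc (m * q) u))
  multipartite-value : q * (2 + m) ∸ q ≡ suc m * q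
  multipartite-value = trans (cong (_∸ q) (*-comm q (2 + m))) (m+n∸m≡n q (suc m * q))
  b₂≡ : m * q + suc u ≡ b₂
  b₂≡ = +-comm (m * q) (suc u)
  b₃≡ : q * (2 + m) ∸ suc u + 1 ≡ b₃
  b₃≡ = trans (cong (λ z → z ∸ suc u + 1) (block-sizes m u e)) (m+n∸[1+n]+1≡m b₃ u)
  b₃+1≡ : q * (2 + m) ∸ suc u + 2 ≡ b₃ + 1
  b₃+1≡ = trans (sym (+-assoc _ 1 1)) (cong (_+ 1) b₃≡)
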